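{- Let $G$ be a finite abelian group, $S=\{s,-s,s',-s',s_0\}\subseteq G\setminus\{0\}$ a generating set of $G$ with $|S|=5$, $o(s_0)=2$ and $o(s),o(s')>2$. If $\mathrm{Cay}(G,S)$ admits a perfect code, then $2\mid o(s)o(s')$.
   Context: $\mathrm{Cay}(G,S)$ has vertex set $G$ with $x\sim y$ iff $y-x\in S$. A perfect code is a vertex set $C$ such that every vertex is at distance at most $1$ from exactly one vertex of $C$. $o(x)$ is the order of $x$. -}

module Defs where

open import Level using (Level; _⊔_) renaming (suc to lsuc)
open import Algebra.Bundles using (AbelianGroup)
open import Data.Nat using (ℕ; zero; suc; _<_)
open import Data.Fin using (Fin)
open import Data.List using (List; foldr)
open import Data.List.Relation.Unary.All using (All)
open import Data.Product using (Σ; ∃; _×_)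
open import Data.Sum using (_⊎_)
open import Relation.Nullary using (¬_)

module _ {c ℓ : Level} (G : AbelianGroup c ℓ) where
  open AbelianGroup G

  IsFinite : Set (c ⊔ ℓ)
  IsFinite = Σ ℕ λ n → Σ (Fin n → Carrier) λ f → ∀ x → ∃ λ i → f i ≈ x

  -- n-fold multiple n·x (written additively in the paper)
  mul : ℕ → Carrier → Carrier
  mul zero    x = ε
  mul (suc n) x = x ∙ mul n x

  IsOrder : Carrier → ℕ → Set ℓ
  IsOrder x n = (0 < n) × (mul n x ≈ ε) × (∀ m → 0 < m → m < n → ¬ (mul m x ≈ ε))

  sumL : List Carrier → Carrier
  sumL = foldr _∙_ ε

  Generates : (Carrier → Set ℓ) → Set (c ⊔ ℓ)
  Generates S = ∀ g → ∃ λ (w : List Carrier) →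
    All (λ x → S x ⊎ S (x ⁻¹)) w × (sumL w ≈ g)

  Adj : (Carrier → Set ℓ) → Carrier → Carrier → Set ℓ
  Adj S x y = S (y ∙ x ⁻¹)

  Dist≤1 : (Carrier → Set ℓ) → Carrier → Carrier → Set ℓ
  Dist≤1 S v u = (v ≈ u) ⊎ Adj S u v ⊎ Adj S v u

  IsPerfectCode : {ℓ′ : Level} → (Carrier → Set ℓ) → (Carrier → Set ℓ′) → Set (c ⊔ ℓ ⊔ ℓ′)
  IsPerfectCode S C = ∀ v →
    (∃ λ u → C u × Dist≤1 S v u) ×
    (∀ u u′ → C u → Dist≤1 S v u → C u′ → Dist≤1 S v u′ → u ≈ u′)

  HasPerfectCode : (Carrier → Set ℓ) → Set (lsuc c ⊔ ℓ)
  HasPerfectCode S = ∃ λ (C : Carrier → Set c) → IsPerfectCode S C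

{-# OPTIONS --safe #-}
-- Suppose N = o·o′ is odd. Then N·s = N·s′ = 0, so 0, ±s, ±s′ all lie in the subgroup
-- K = {x | N·x = 0}, which has odd order because x ↦ -x pairs off its non-zero elements.
-- A perfect code C tiles G by translates of the ball {s₀, 0, ±s, ±s′}. Counting K and its
-- coset K + s₀ along this tiling gives |K| = b + 5a = a + 5b, where a = |C ∩ K| and
-- b = |C ∩ (K + s₀)|. Hence a = b and |K| = 6a is even, a contradiction.
module Submission where

open import Defs
open import Level using (Level; _⊔_)
open import Algebra.Bundles using (AbelianGroup)
import Algebra.Properties.AbelianGroup as AbelianGroupProperties
open import Data.Nat using (ℕ; zero; suc; _+_; _*_; _>_)
open import Data.Nat.Divisibility using (_∣_; divides)
open import Data.Nat.Properties
  using (+-comm; +-identityʳ; *-identityʳ; *-zeroʳ; *-comm; *-assoc; *-distribˡ-+;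
         +-cancelʳ-≡; *-cancelˡ-≡; even≢odd; +-commutativeSemigroup)
open import Data.Nat.Tactic.RingSolver using (solve-∀)
open import Data.Fin as Fin using (Fin)
open import Data.Fin.Properties using (_<?_; <-cmp; sequence)
open import Data.List using (List; []; _∷_; length; tabulate; deduplicate)
open import Data.List.Relation.Unary.All using (All; []; _∷_)
import Data.List.Relation.Unary.All as All
open import Data.List.Relation.Unary.All.Properties using (All¬⇒¬Any)
open import Data.List.Relation.Unary.Any using (Any; here; there; index)
import Data.List.Relation.Unary.Any as Any
open import Data.List.Relation.Unary.AllPairs using (AllPairs; []; _∷_)
open import Data.List.Membership.Setoid.Properties
  using (index-injective; ∈-resp-≈; ∈-deduplicate⁺; ∈-tabulate⁺)
open import Data.List.Relation.Unary.Unique.DecSetoid.Properties using (deduplicate-!)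
open import Data.Product using (∃; _,_; proj₁; proj₂)
open import Data.Sum using (_⊎_; inj₁; inj₂)
open import Data.Empty using (⊥-elim)
open import Effect.Monad using (RawMonad)
open import Function.Bundles using (Inverse)
open import Relation.Binary.Bundles using (DecSetoid)
open import Relation.Binary.Core using (_Preserves_⟶_)
open import Relation.Binary.Definitions using (Decidable; _Respects_; tri<; tri≈; tri>)
open import Relation.Nullary using (¬_; Dec; yes; no; ¬?)
open import Relation.Nullary.Decidable using (map′; ¬¬-excluded-middle)
open import Relation.Nullary.Negation using (¬¬-Monad; ¬¬-map)
import Relation.Binary.PropositionalEquality as ≡
open ≡ using (_≡_; _≢_)

private variable
  ℓ₁ ℓ₂ p q : Level
  A : Set ℓ₁
  B : Set ℓ₂
  P : Set p
  Q : Set q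

𝟙 : Dec P → ℕ
𝟙 (yes _) = 1
𝟙 (no _)  = 0

𝟙-cong : (P → Q) → (Q → P) → (p? : Dec P) (q? : Dec Q) → 𝟙 p? ≡ 𝟙 q?
𝟙-cong f g (yes p) (yes q) = ≡.refl
𝟙-cong f g (yes p) (no ¬q) = ⊥-elim (¬q (f p))
𝟙-cong f g (no ¬p) (yes q) = ⊥-elim (¬p (g q))
𝟙-cong f g (no ¬p) (no ¬q) = ≡.refl

𝟙-yes : P → (p? : Dec P) → 𝟙 p? ≡ 1
𝟙-yes p (yes _) = ≡.refl
𝟙-yes p (no ¬p) = ⊥-elim (¬p p)

𝟙-no : ¬ P → (p? : Dec P) → 𝟙 p? ≡ 0
𝟙-no ¬p (yes p) = ⊥-elim (¬p p)
𝟙-no ¬p (no _)  = ≡.refl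

𝟙+𝟙-¬ : (p? : Dec P) → 𝟙 p? + 𝟙 (¬? p?) ≡ 1
𝟙+𝟙-¬ (yes _) = ≡.refl
𝟙+𝟙-¬ (no _)  = ≡.refl

𝟙-<-total : ∀ {n} {i j : Fin n} → i ≢ j → 𝟙 (i <? j) + 𝟙 (j <? i) ≡ 1
𝟙-<-total {i = i} {j} i≢j with <-cmp i j
... | tri< i<j _ j≮i = ≡.cong₂ _+_ (𝟙-yes i<j (i <? j)) (𝟙-no j≮i (j <? i))
... | tri≈ _ i≡j _   = ⊥-elim (i≢j i≡j)
... | tri> i≮j _ j<i = ≡.cong₂ _+_ (𝟙-no i≮j (i <? j)) (𝟙-yes j<i (j <? i))

∑ : List A → (A → ℕ) → ℕ
∑ []       f = 0
∑ (x ∷ xs) f = f x + ∑ xs f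

module _ {f g : A → ℕ} where

  ∑-cong : ∀ xs → (∀ x → f x ≡ g x) → ∑ xs f ≡ ∑ xs g
  ∑-cong []       f≗g = ≡.refl
  ∑-cong (x ∷ xs) f≗g = ≡.cong₂ _+_ (f≗g x) (∑-cong xs f≗g)

  ∑-distrib-+ : ∀ xs → ∑ xs (λ x → f x + g x) ≡ ∑ xs f + ∑ xs g
  ∑-distrib-+ []       = ≡.refl
  ∑-distrib-+ (x ∷ xs) =
    ≡.trans (≡.cong (f x + g x +_) (∑-distrib-+ xs)) (+-interchange (f x) (g x) (∑ xs f) (∑ xs g))
    where open import Algebra.Properties.CommutativeSemigroup +-commutativeSemigroup
            renaming (interchange to +-interchange)

∑-const : ∀ {f : A → ℕ} {k} xs → All (λ x → f x ≡ k) xs → ∑ xs f ≡ length xs * k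
∑-const []       []           = ≡.refl
∑-const (x ∷ xs) (fx≡k ∷ fxs) = ≡.cong₂ _+_ fx≡k (∑-const xs fxs)

∑-zero : ∀ {f : A → ℕ} xs → All (λ x → f x ≡ 0) xs → ∑ xs f ≡ 0
∑-zero xs fxs≡0 = ≡.trans (∑-const xs fxs≡0) (*-zeroʳ (length xs))

*-distribˡ-∑ : ∀ k xs (f : A → ℕ) → k * ∑ xs f ≡ ∑ xs (λ x → k * f x)
*-distribˡ-∑ k []       f = *-zeroʳ k
*-distribˡ-∑ k (x ∷ xs) f = ≡.trans (*-distribˡ-+ k (f x) _) (≡.cong (k * f x +_) (*-distribˡ-∑ k xs f))

∑-comm : ∀ xs (ys : List B) (f : A → B → ℕ) →
         ∑ xs (λ x → ∑ ys (f x)) ≡ ∑ ys (λ y → ∑ xs (λ x → f x y))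
∑-comm []       ys f = ≡.sym (∑-zero ys (All.universal (λ _ → ≡.refl) ys))
∑-comm (x ∷ xs) ys f = ≡.trans (≡.cong (∑ ys (f x) +_) (∑-comm xs ys f)) (≡.sym (∑-distrib-+ ys))

∑-𝟙-exactlyOne : ∀ {P : A → Set p} (P? : ∀ x → Dec (P x)) xs →
                 Any P xs → AllPairs (λ x y → P x → ¬ P y) xs → ∑ xs (λ x → 𝟙 (P? x)) ≡ 1
∑-𝟙-exactlyOne P? (x ∷ xs) any (x-excludes ∷ _) with P? x
... | yes px = ≡.cong suc (∑-zero xs (All.map (λ excludes-y → 𝟙-no (excludes-y px) (P? _)) x-excludes))
∑-𝟙-exactlyOne P? (x ∷ xs) (here px)   _        | no ¬px = ⊥-elim (¬px px)
∑-𝟙-exactlyOne P? (x ∷ xs) (there any) (_ ∷ ap) | no ¬px = ∑-𝟙-exactlyOne P? xs any ap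

module Counting {c ℓ} (D : DecSetoid c ℓ) where
  open DecSetoid D
  open import Data.List.Membership.Setoid setoid using (_∈_)
  open import Data.List.Relation.Unary.Unique.Setoid setoid using (Unique)

  index-cong : ∀ {x y xs} → Unique xs → x ≈ y → (x∈xs : x ∈ xs) (y∈xs : y ∈ xs) →
               index x∈xs ≡ index y∈xs
  index-cong _          x≈y (here _)     (here _)     = ≡.refl
  index-cong (z∉zs ∷ _) x≈y (here x≈z)   (there y∈zs) =
    ⊥-elim (All¬⇒¬Any z∉zs (∈-resp-≈ setoid (trans (sym x≈y) x≈z) y∈zs))
  index-cong (z∉zs ∷ _) x≈y (there x∈zs) (here y≈z)   =
    ⊥-elim (All¬⇒¬Any z∉zs (∈-resp-≈ setoid (trans x≈y y≈z) x∈zs))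
  index-cong (_ ∷ uniq) x≈y (there x∈zs) (there y∈zs) = ≡.cong Fin.suc (index-cong uniq x≈y x∈zs y∈zs)

  δ-sum : ∀ {F : Carrier → ℕ} → F Preserves _≈_ ⟶ _≡_ → ∀ {z xs} → Unique xs → z ∈ xs →
          ∑ xs (λ y → F y * 𝟙 (z ≟ y)) ≡ F z
  δ-sum {F} F-cong {z} {y ∷ ys} (y∉ys ∷ _) _ with z ≟ y
  ... | yes z≈y = begin
    F y * 1 + ∑ ys (λ w → F w * 𝟙 (z ≟ w))  ≡⟨ ≡.cong₂ _+_ (*-identityʳ (F y)) (∑-zero ys (All.map vanish y∉ys)) ⟩
    F y + 0                                 ≡⟨ +-identityʳ (F y) ⟩
    F y                                     ≡⟨ F-cong (sym z≈y) ⟩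
    F z                                     ∎
    where
    open ≡.≡-Reasoning
    vanish : ∀ {w} → ¬ y ≈ w → F w * 𝟙 (z ≟ w) ≡ 0
    vanish y≉w = ≡.trans (≡.cong (F _ *_) (𝟙-no (λ z≈w → y≉w (trans (sym z≈y) z≈w)) (z ≟ _))) (*-zeroʳ (F _))
  δ-sum {F} F-cong {xs = y ∷ _} (_ ∷ uniq) (here z≈y)   | no z≉y = ⊥-elim (z≉y z≈y)
  δ-sum {F} F-cong {xs = y ∷ _} (_ ∷ uniq) (there z∈ys) | no z≉y =
    ≡.cong₂ _+_ (*-zeroʳ (F y)) (δ-sum F-cong uniq z∈ys)

  module Enumerated (R : List Carrier) (R-unique : Unique R) (R-complete : ∀ x → x ∈ R) where

    ∑-inverse : ∀ (φ : Inverse setoid setoid) {F : Carrier → ℕ} → F Preserves _≈_ ⟶ _≡_ →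
                ∑ R (λ x → F (Inverse.to φ x)) ≡ ∑ R F
    ∑-inverse φ {F} F-cong = begin
      ∑ R (λ x → F (to x))                               ≡⟨ ∑-cong R (λ x → ≡.sym (δ-sum F-cong R-unique (R-complete (to x)))) ⟩
      ∑ R (λ x → ∑ R (λ y → F y * 𝟙 (to x ≟ y)))         ≡⟨ ∑-comm R R _ ⟩
      ∑ R (λ y → ∑ R (λ x → F y * 𝟙 (to x ≟ y)))         ≡⟨ ∑-cong R (λ y → ≡.sym (*-distribˡ-∑ (F y) R _)) ⟩
      ∑ R (λ y → F y * ∑ R (λ x → 𝟙 (to x ≟ y)))         ≡⟨ ∑-cong R (λ y → ≡.cong (F y *_) (∑-cong R (𝟙-transpose y))) ⟩
      ∑ R (λ y → F y * ∑ R (λ x → 1 * 𝟙 (from y ≟ x)))   ≡⟨ ∑-cong R (λ y → ≡.cong (F y *_) (δ-sum (λ _ → ≡.refl) R-unique (R-complete (from y)))) ⟩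
      ∑ R (λ y → F y * 1)                                ≡⟨ ∑-cong R (λ y → *-identityʳ (F y)) ⟩
      ∑ R F                                              ∎
      where
      open Inverse φ
      open ≡.≡-Reasoning
      𝟙-transpose : ∀ y x → 𝟙 (to x ≟ y) ≡ 1 * 𝟙 (from y ≟ x)
      𝟙-transpose y x = ≡.trans (𝟙-cong (λ p → inverseʳ (sym p)) (λ q → inverseˡ (sym q)) (to x ≟ y) (from y ≟ x))
                          (≡.sym (+-identityʳ _))

    position : Carrier → Fin (length R)
    position x = index (R-complete x)

    position-cong : ∀ {x y} → x ≈ y → position x ≡ position y
    position-cong x≈y = index-cong R-unique x≈y (R-complete _) (R-complete _)

    position-injective : ∀ {x y} → position x ≡ position y → x ≈ y
    position-injective = index-injective setoid (R-complete _) (R-complete _)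

    ∑-involution-even : ∀ (ι : Carrier → Carrier) → ι Preserves _≈_ ⟶ _≈_ → (∀ x → ι (ι x) ≈ x) →
                        ∀ {F : Carrier → ℕ} → F Preserves _≈_ ⟶ _≡_ → (∀ x → F (ι x) ≡ F x) →
                        (∀ x → ι x ≈ x → F x ≡ 0) → ∃ λ m → ∑ R F ≡ 2 * m
    ∑-involution-even ι ι-cong ι-involutive {F} F-cong F∘ι≗F F-fixed = ∑ R G , (begin
      ∑ R F                                          ≡⟨ ∑-cong R split ⟩
      ∑ R (λ x → F x * leads x + F x * leads (ι x))  ≡⟨ ∑-distrib-+ R ⟩
      ∑ R G + ∑ R (λ x → F x * leads (ι x))          ≡⟨ ≡.cong (∑ R G +_) (∑-cong R (λ x → ≡.cong (_* leads (ι x)) (≡.sym (F∘ι≗F x)))) ⟩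
      ∑ R G + ∑ R (λ x → G (ι x))                    ≡⟨ ≡.cong (∑ R G +_) (∑-inverse ι-inverse G-cong) ⟩
      ∑ R G + ∑ R G                                  ≡⟨ ≡.cong (∑ R G +_) (+-identityʳ (∑ R G)) ⟨
      2 * ∑ R G                                      ∎)
      where
      open ≡.≡-Reasoning
      -- of the two elements of a free orbit {x, ι x}, exactly one comes first in R
      leads : Carrier → ℕ
      leads x = 𝟙 (position x <? position (ι x))

      G : Carrier → ℕ
      G x = F x * leads x

      G-cong : G Preserves _≈_ ⟶ _≡_
      G-cong x≈y = ≡.cong₂ _*_ (F-cong x≈y)
        (≡.cong₂ (λ i j → 𝟙 (i <? j)) (position-cong x≈y) (position-cong (ι-cong x≈y)))

      ι-inverse : Inverse setoid setoid
      ι-inverse = record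
        { to = ι ; from = ι ; to-cong = ι-cong ; from-cong = ι-cong
        ; inverse = (λ y≈ιx → trans (ι-cong y≈ιx) (ι-involutive _)) , (λ y≈ιx → trans (ι-cong y≈ιx) (ι-involutive _))
        }

      split : ∀ x → F x ≡ F x * leads x + F x * leads (ι x)
      split x with ι x ≟ x
      ... | yes ιx≈x rewrite F-fixed x ιx≈x = ≡.refl
      ... | no ιx≉x = begin
        F x                                                  ≡⟨ *-identityʳ (F x) ⟨
        F x * 1                                              ≡⟨ ≡.cong (F x *_) (𝟙-<-total (λ eq → ιx≉x (sym (position-injective eq)))) ⟨
        F x * (leads x + 𝟙 (position (ι x) <? position x))   ≡⟨ ≡.cong (λ i → F x * (leads x + 𝟙 (position (ι x) <? i))) (position-cong (ι-involutive x)) ⟨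
        F x * (leads x + leads (ι x))                        ≡⟨ *-distribˡ-+ (F x) (leads x) _ ⟩
        F x * leads x + F x * leads (ι x)                    ∎

module GroupCounting {c ℓ} (G : AbelianGroup c ℓ) (_≟_ : Decidable (AbelianGroup._≈_ G)) where
  open AbelianGroup G
  open AbelianGroupProperties G using (⁻¹-involutive; ε⁻¹≈ε; ⁻¹-injective; //-rightDividesˡ; //-rightDividesʳ)
  open import Data.Product using (_×_)
  open import Data.List.Membership.Setoid setoid using (_∈_)
  open import Data.List.Relation.Unary.Unique.Setoid setoid using (Unique)

  decSetoid : DecSetoid c ℓ
  decSetoid = record { isDecEquivalence = record { isEquivalence = isEquivalence ; _≟_ = _≟_ } }

  enumerate : IsFinite G → ∃ λ R → Unique R × ∀ x → x ∈ R
  enumerate (n , f , surjective) =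
    deduplicate _≟_ (tabulate f) , deduplicate-! decSetoid (tabulate f) , λ x →
      let i , fi≈x = surjective x in
      ∈-deduplicate⁺ setoid _≟_ (λ z≈y x≈y → trans x≈y (sym z≈y)) (∈-resp-≈ setoid fi≈x (∈-tabulate⁺ setoid i))

  module Enumerated (R : List Carrier) (R-unique : Unique R) (R-complete : ∀ x → x ∈ R) where
    open Counting decSetoid using (δ-sum)
    open Counting.Enumerated decSetoid R R-unique R-complete public

    ∑-translate : ∀ t {F : Carrier → ℕ} → F Preserves _≈_ ⟶ _≡_ → ∑ R (λ x → F (x ∙ t)) ≡ ∑ R F
    ∑-translate t = ∑-inverse record
      { to = _∙ t ; from = _∙ t ⁻¹ ; to-cong = ∙-congʳ ; from-cong = ∙-congʳ
      ; inverse = (λ {x} y≈x-t → trans (∙-congʳ y≈x-t) (//-rightDividesˡ t x))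
                , (λ {x} y≈x+t → trans (∙-congʳ y≈x+t) (//-rightDividesʳ t x))
      }

    ∑-𝟙-odd : ∀ {P : Carrier → Set p} (P? : ∀ x → Dec (P x)) → P Respects _≈_ →
              (∀ {x} → P x → P (x ⁻¹)) → P ε → (∀ {x} → P x → x ∙ x ≈ ε → x ≈ ε) →
              ∃ λ m → ∑ R (λ x → 𝟙 (P? x)) ≡ suc (2 * m)
    ∑-𝟙-odd {P = P} P? P-resp P-⁻¹ P-ε P-noInvolution =
      let m , ∑W≡2m = ∑-involution-even _⁻¹ ⁻¹-cong ⁻¹-involutive W-cong W∘⁻¹≗W W-fixed in
      m , (begin
      ∑ R F                                ≡⟨ ∑-cong R split ⟩
      ∑ R (λ x → F x * 𝟙 (ε ≟ x) + W x)    ≡⟨ ∑-distrib-+ R ⟩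
      ∑ R (λ x → F x * 𝟙 (ε ≟ x)) + ∑ R W  ≡⟨ ≡.cong₂ _+_ (δ-sum F-cong R-unique (R-complete ε)) ∑W≡2m ⟩
      F ε + 2 * m                          ≡⟨ ≡.cong (_+ 2 * m) (𝟙-yes P-ε (P? ε)) ⟩
      suc (2 * m)                          ∎)
      where
      open ≡.≡-Reasoning
      F : Carrier → ℕ
      F x = 𝟙 (P? x)

      W : Carrier → ℕ
      W x = F x * 𝟙 (¬? (ε ≟ x))

      F-cong : F Preserves _≈_ ⟶ _≡_
      F-cong x≈y = 𝟙-cong (P-resp x≈y) (P-resp (sym x≈y)) (P? _) (P? _)

      W-cong : W Preserves _≈_ ⟶ _≡_
      W-cong x≈y = ≡.cong₂ _*_ (F-cong x≈y)
        (𝟙-cong (λ ε≉x ε≈y → ε≉x (trans ε≈y (sym x≈y))) (λ ε≉y ε≈x → ε≉y (trans ε≈x x≈y)) (¬? (ε ≟ _)) (¬? (ε ≟ _)))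

      W∘⁻¹≗W : ∀ x → W (x ⁻¹) ≡ W x
      W∘⁻¹≗W x = ≡.cong₂ _*_
        (𝟙-cong (λ p → P-resp (⁻¹-involutive x) (P-⁻¹ p)) P-⁻¹ (P? _) (P? _))
        (𝟙-cong (λ ε≉x⁻¹ ε≈x → ε≉x⁻¹ (trans (sym ε⁻¹≈ε) (⁻¹-cong ε≈x)))
                (λ ε≉x ε≈x⁻¹ → ε≉x (⁻¹-injective (trans ε⁻¹≈ε ε≈x⁻¹))) (¬? (ε ≟ _)) (¬? (ε ≟ _)))

      W-fixed : ∀ x → x ⁻¹ ≈ x → W x ≡ 0
      W-fixed x x⁻¹≈x with P? x | ε ≟ x
      ... | no _   | _      = ≡.refl
      ... | yes _  | yes _  = ≡.refl
      ... | yes px | no ε≉x = ⊥-elim (ε≉x (sym (P-noInvolution px (trans (∙-congˡ (sym x⁻¹≈x)) (inverseʳ x)))))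

      split : ∀ x → F x ≡ F x * 𝟙 (ε ≟ x) + W x
      split x = begin
        F x                                  ≡⟨ *-identityʳ (F x) ⟨
        F x * 1                              ≡⟨ ≡.cong (F x *_) (𝟙+𝟙-¬ (ε ≟ x)) ⟨
        F x * (𝟙 (ε ≟ x) + 𝟙 (¬? (ε ≟ x)))   ≡⟨ *-distribˡ-+ (F x) _ _ ⟩
        F x * 𝟙 (ε ≟ x) + W x                ∎

    ∑-tiling : ∀ {C : Carrier → Set p} (C? : ∀ x → Dec (C x)) → C Respects _≈_ →
               ∀ ts → (∀ v → ∑ ts (λ t → 𝟙 (C? (v ∙ t))) ≡ 1) →
               ∀ {g : Carrier → ℕ} → g Preserves _≈_ ⟶ _≡_ →
               ∑ R g ≡ ∑ ts (λ t → ∑ R (λ v → g (v ∙ t ⁻¹) * 𝟙 (C? v)))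
    ∑-tiling C? C-resp ts tiles {g} g-cong = begin
      ∑ R g                                                               ≡⟨ ∑-cong R (λ v → ≡.trans (≡.cong (g v *_) (tiles v)) (*-identityʳ (g v))) ⟨
      ∑ R (λ v → g v * ∑ ts (λ t → 𝟙 (C? (v ∙ t))))                       ≡⟨ ∑-cong R (λ v → *-distribˡ-∑ (g v) ts _) ⟩
      ∑ R (λ v → ∑ ts (λ t → g v * 𝟙 (C? (v ∙ t))))                       ≡⟨ ∑-comm R ts _ ⟩
      ∑ ts (λ t → ∑ R (λ v → g v * 𝟙 (C? (v ∙ t))))                       ≡⟨ ∑-cong ts (λ t → ∑-translate (t ⁻¹) (gC-cong t)) ⟨
      ∑ ts (λ t → ∑ R (λ v → g (v ∙ t ⁻¹) * 𝟙 (C? ((v ∙ t ⁻¹) ∙ t))))     ≡⟨ ∑-cong ts (λ t → ∑-cong R (λ v → ≡.cong (g (v ∙ t ⁻¹) *_) (𝟙C-cong (//-rightDividesˡ t v)))) ⟩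
      ∑ ts (λ t → ∑ R (λ v → g (v ∙ t ⁻¹) * 𝟙 (C? v)))                    ∎
      where
      open ≡.≡-Reasoning
      𝟙C-cong : ∀ {x y} → x ≈ y → 𝟙 (C? x) ≡ 𝟙 (C? y)
      𝟙C-cong x≈y = 𝟙-cong (C-resp x≈y) (C-resp (sym x≈y)) (C? _) (C? _)

      gC-cong : ∀ t → (λ v → g v * 𝟙 (C? (v ∙ t))) Preserves _≈_ ⟶ _≡_
      gC-cong t x≈y = ≡.cong₂ _*_ (g-cong x≈y) (𝟙C-cong (∙-congʳ x≈y))

module Multiples {c ℓ} (G : AbelianGroup c ℓ) where
  open AbelianGroup G
  open AbelianGroupProperties G using (inverseˡ-unique)
  open import Algebra.Properties.CommutativeMonoid.Mult commutativeMonoid public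
    using (_×_; ×-congʳ; ×-congˡ; ×-distrib-+; ×-assocˡ)
  open import Relation.Binary.Reasoning.Setoid setoid

  mul≡× : ∀ n x → mul G n x ≡ n × x
  mul≡× zero    x = ≡.refl
  mul≡× (suc n) x = ≡.cong (x ∙_) (mul≡× n x)

  ×-ε : ∀ n → n × ε ≈ ε
  ×-ε n = trans (×-assocˡ ε n 0) (×-congˡ (*-zeroʳ n))

  ×-ε-multiple : ∀ {m x} n → m × x ≈ ε → (n * m) × x ≈ ε
  ×-ε-multiple {m} {x} n mx≈ε = begin
    (n * m) × x  ≈⟨ ×-assocˡ x n m ⟨
    n × (m × x)  ≈⟨ ×-congʳ n mx≈ε ⟩
    n × ε        ≈⟨ ×-ε n ⟩
    ε            ∎

  ×-⁻¹ : ∀ n x → n × (x ⁻¹) ≈ (n × x) ⁻¹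
  ×-⁻¹ n x = inverseˡ-unique (n × (x ⁻¹)) (n × x) (begin
    n × (x ⁻¹) ∙ n × x  ≈⟨ ×-distrib-+ (x ⁻¹) x n ⟨
    n × (x ⁻¹ ∙ x)      ≈⟨ ×-congʳ n (inverseˡ x) ⟩
    n × ε               ≈⟨ ×-ε n ⟩
    ε                   ∎)

  ×-∙-annihilated : ∀ n x {t} → n × t ≈ ε → n × (x ∙ t) ≈ n × x
  ×-∙-annihilated n x {t} nt≈ε = begin
    n × (x ∙ t)    ≈⟨ ×-distrib-+ x t n ⟩
    n × x ∙ n × t  ≈⟨ ∙-congˡ nt≈ε ⟩
    n × x ∙ ε      ≈⟨ identityʳ (n × x) ⟩
    n × x          ∎

  odd-×-involution : ∀ k {x} → x ∙ x ≈ ε → suc (2 * k) × x ≈ x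
  odd-×-involution k {x} x∙x≈ε = begin
    x ∙ (2 * k) × x  ≈⟨ ∙-congˡ (×-congˡ (*-comm 2 k)) ⟩
    x ∙ (k * 2) × x  ≈⟨ ∙-congˡ (×-ε-multiple k (trans (∙-congˡ (identityʳ x)) x∙x≈ε)) ⟩
    x ∙ ε            ≈⟨ identityʳ x ⟩
    x                ∎

module PerfectCode {c ℓ} (G : AbelianGroup c ℓ) (S : AbelianGroup.Carrier G → Set ℓ) where
  open AbelianGroup G
  open AbelianGroupProperties G using (//-rightDividesˡ; xyx⁻¹≈y; x≈y⇒x∙y⁻¹≈ε; ⁻¹-anti-homo-//)
  open import Data.Product using (_×_)
  open import Data.List.Membership.Setoid setoid using (_∈_)
  open import Data.List.Relation.Unary.Unique.Setoid setoid using (Unique)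

  Ball : Carrier → Set ℓ
  Ball t = (t ≈ ε) ⊎ S t

  -- A code in the sense of Defs need not respect ≈, so codewords are counted through its ≈-closure.
  Closure : ∀ {c′} → (Carrier → Set c′) → Carrier → Set (c ⊔ c′ ⊔ ℓ)
  Closure C x = ∃ λ u → C u × u ≈ x

  closure-resp : ∀ {c′} {C : Carrier → Set c′} → Closure C Respects _≈_
  closure-resp x≈y (u , Cu , u≈x) = u , Cu , trans u≈x x≈y

  module _ (S-resp : S Respects _≈_) (S-⁻¹ : ∀ {x} → S x → S (x ⁻¹))
           {c′} {C : Carrier → Set c′} (code : IsPerfectCode G S C) where

    ball⇒dist≤1 : ∀ {v u t} → Ball t → u ≈ v ∙ t → Dist≤1 G S v u
    ball⇒dist≤1 {v} (inj₁ t≈ε) u≈vt = inj₁ (sym (trans u≈vt (trans (∙-congˡ t≈ε) (identityʳ v))))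
    ball⇒dist≤1 {v} {t = t} (inj₂ St) u≈vt =
      inj₂ (inj₂ (S-resp (sym (trans (∙-congʳ u≈vt) (xyx⁻¹≈y v t))) St))

    nearest-codeword : ∀ v → ∃ λ t → Ball t × Closure C (v ∙ t)
    nearest-codeword v with proj₁ (code v)
    ... | u , Cu , dist = u ∙ v ⁻¹ , ball dist , u , Cu , sym (trans (comm v (u ∙ v ⁻¹)) (//-rightDividesˡ v u))
      where
      ball : Dist≤1 G S v u → Ball (u ∙ v ⁻¹)
      ball (inj₁ v≈u)             = inj₁ (x≈y⇒x∙y⁻¹≈ε (sym v≈u))
      ball (inj₂ (inj₁ Sv∙u⁻¹))   = inj₂ (S-resp (⁻¹-anti-homo-// v u) (S-⁻¹ Sv∙u⁻¹))
      ball (inj₂ (inj₂ Su∙v⁻¹))   = inj₂ Su∙v⁻¹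

    codeword-unique : ∀ v {t t′} → Ball t → Ball t′ → Closure C (v ∙ t) → Closure C (v ∙ t′) → t ≈ t′
    codeword-unique v {t} {t′} Bt Bt′ (u , Cu , u≈vt) (u′ , Cu′ , u′≈vt′) = begin
      t              ≈⟨ xyx⁻¹≈y v t ⟨
      v ∙ t ∙ v ⁻¹   ≈⟨ ∙-congʳ (trans (sym u≈vt) (trans u≈u′ u′≈vt′)) ⟩
      v ∙ t′ ∙ v ⁻¹  ≈⟨ xyx⁻¹≈y v t′ ⟩
      t′             ∎
      where
      open import Relation.Binary.Reasoning.Setoid setoid
      u≈u′ : u ≈ u′
      u≈u′ = proj₂ (code v) u u′ Cu (ball⇒dist≤1 Bt u≈vt) Cu′ (ball⇒dist≤1 Bt′ u′≈vt′)

    ∑-𝟙-codeword : (C? : ∀ x → Dec (Closure C x)) → ∀ {ts} → Unique ts → All Ball ts →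
                   (∀ {t} → Ball t → t ∈ ts) → ∀ v → ∑ ts (λ t → 𝟙 (C? (v ∙ t))) ≡ 1
    ∑-𝟙-codeword C? {ts} uniq balls complete v =
      ∑-𝟙-exactlyOne (λ t → C? (v ∙ t)) ts
        (let t , Bt , Cvt = nearest-codeword v in
         Any.map (λ t≈t′ → closure-resp (∙-congˡ t≈t′) Cvt) (complete Bt))
        (separated balls uniq)
      where
      separated : ∀ {ts} → All Ball ts → Unique ts →
                  AllPairs (λ t t′ → Closure C (v ∙ t) → ¬ Closure C (v ∙ t′)) ts
      separated []          []           = []
      separated (Bt ∷ Bts) (t∉ts ∷ uniq) =
        All.zipWith (λ (t≉t′ , Bt′) Cvt Cvt′ → t≉t′ (codeword-unique v Bt Bt′ Cvt Cvt′)) (t∉ts , Bts)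
        ∷ separated Bts uniq

b+5a≡a+5b⇒b+5a≡6a : ∀ a b → b + 5 * a ≡ a + 5 * b → b + 5 * a ≡ 6 * a
b+5a≡a+5b⇒b+5a≡6a a b eq = begin
  b + 5 * a  ≡⟨ ≡.cong (_+ 5 * a) a≡b ⟨
  a + 5 * a  ≡⟨ solve-∀ ⟩
  6 * a      ∎
  where
  open ≡.≡-Reasoning
  regroup : ∀ a b → b + 5 * a ≡ 4 * a + (b + a)
  regroup = solve-∀
  a≡b : a ≡ b
  a≡b = *-cancelˡ-≡ a b 4 (+-cancelʳ-≡ (b + a) (4 * a) (4 * b) (begin
    4 * a + (b + a)  ≡⟨ regroup a b ⟨
    b + 5 * a        ≡⟨ eq ⟩
    a + 5 * b        ≡⟨ regroup b a ⟩
    4 * b + (a + b)  ≡⟨ ≡.cong (4 * b +_) (+-comm a b) ⟩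
    4 * b + (b + a)  ∎))

module OddTiling {c ℓ} (G : AbelianGroup c ℓ) (_≟_ : Decidable (AbelianGroup._≈_ G)) where
  open AbelianGroup G
  open AbelianGroupProperties G using (ε⁻¹≈ε; inverseʳ-unique; //-rightDividesˡ)
  open import Algebra.Properties.CommutativeSemigroup commutativeSemigroup using (xy∙z≈xz∙y)
  open Multiples G
  open GroupCounting G _≟_
  open import Data.List.Membership.Setoid setoid using (_∈_)
  open import Data.List.Relation.Unary.Unique.Setoid setoid using (Unique)

  module _ (R : List Carrier) (R-unique : Unique R) (R-complete : ∀ x → x ∈ R) where
    open Enumerated R R-unique R-complete

    ¬odd-tiling : ∀ k {s s′ s₀} → suc (2 * k) × s ≈ ε → suc (2 * k) × s′ ≈ ε → s₀ ∙ s₀ ≈ ε →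
                  ∀ {C : Carrier → Set p} (C? : ∀ x → Dec (C x)) → C Respects _≈_ →
                  ¬ (∀ v → ∑ (s₀ ∷ ε ∷ s ∷ s ⁻¹ ∷ s′ ∷ s′ ⁻¹ ∷ []) (λ t → 𝟙 (C? (v ∙ t))) ≡ 1)
    ¬odd-tiling k {s} {s′} {s₀} Ns≈ε Ns′≈ε s₀∙s₀≈ε C? C-resp tiles =
      let m , |K|≡1+2m = |K|-odd in
      even≢odd (3 * a) m (begin
        2 * (3 * a)  ≡⟨ *-assoc 2 3 a ⟨
        6 * a        ≡⟨ b+5a≡a+5b⇒b+5a≡6a a b (≡.trans (≡.sym |K|≡b+5a) |K|≡a+5b) ⟨
        b + 5 * a    ≡⟨ |K|≡b+5a ⟨
        ∑ R 𝟙K       ≡⟨ |K|≡1+2m ⟩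
        suc (2 * m)  ∎)
      where
      open ≡.≡-Reasoning
      N : ℕ
      N = suc (2 * k)

      K : Carrier → Set ℓ
      K x = N × x ≈ ε

      𝟙K : Carrier → ℕ
      𝟙K x = 𝟙 ((N × x) ≟ ε)

      𝟙K-cong : 𝟙K Preserves _≈_ ⟶ _≡_
      𝟙K-cong x≈y = 𝟙-cong (trans (×-congʳ N (sym x≈y))) (trans (×-congʳ N x≈y)) (_ ≟ ε) (_ ≟ ε)

      𝟙K-invariant : ∀ {t} → K t → ∀ x → 𝟙K (x ∙ t) ≡ 𝟙K x
      𝟙K-invariant Kt x =
        𝟙-cong (trans (sym (×-∙-annihilated N x Kt))) (trans (×-∙-annihilated N x Kt)) (_ ≟ ε) (_ ≟ ε)

      K-⁻¹ : ∀ {x} → K x → K (x ⁻¹)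
      K-⁻¹ Kx = trans (×-⁻¹ N _) (trans (⁻¹-cong Kx) ε⁻¹≈ε)

      |K|-odd : ∃ λ m → ∑ R 𝟙K ≡ suc (2 * m)
      |K|-odd = ∑-𝟙-odd (λ x → (N × x) ≟ ε) (λ x≈y → trans (×-congʳ N (sym x≈y))) K-⁻¹ (×-ε N)
        (λ Kx x∙x≈ε → trans (sym (odd-×-involution k x∙x≈ε)) Kx)

      a b : ℕ
      a = ∑ R (λ v → 𝟙K v * 𝟙 (C? v))
      b = ∑ R (λ v → 𝟙K (v ∙ s₀) * 𝟙 (C? v))

      ∑-by-codewords : ∀ {g : Carrier → ℕ} → g Preserves _≈_ ⟶ _≡_ → (∀ {t} → K t → ∀ x → g (x ∙ t) ≡ g x) →
                       ∑ R g ≡ ∑ R (λ v → g (v ∙ s₀ ⁻¹) * 𝟙 (C? v)) + 5 * ∑ R (λ v → g v * 𝟙 (C? v))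
      ∑-by-codewords {g} g-cong g-invariant =
        ≡.trans (∑-tiling C? C-resp (s₀ ∷ ε ∷ s ∷ s ⁻¹ ∷ s′ ∷ s′ ⁻¹ ∷ []) tiles g-cong)
          (≡.cong (∑ R (λ v → g (v ∙ s₀ ⁻¹) * 𝟙 (C? v)) +_) (∑-const (ε ∷ s ∷ s ⁻¹ ∷ s′ ∷ s′ ⁻¹ ∷ [])
            (All.map translate-by (×-ε N ∷ Ns≈ε ∷ K-⁻¹ Ns≈ε ∷ Ns′≈ε ∷ K-⁻¹ Ns′≈ε ∷ []))))
        where
        translate-by : ∀ {t} → K t → ∑ R (λ v → g (v ∙ t ⁻¹) * 𝟙 (C? v)) ≡ ∑ R (λ v → g v * 𝟙 (C? v))
        translate-by Kt = ∑-cong R (λ v → ≡.cong (_* 𝟙 (C? v)) (g-invariant (K-⁻¹ Kt) v))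

      |K|≡b+5a : ∑ R 𝟙K ≡ b + 5 * a
      |K|≡b+5a = ≡.trans (∑-by-codewords 𝟙K-cong 𝟙K-invariant)
        (≡.cong (_+ 5 * a) (∑-cong R (λ v → ≡.cong (_* 𝟙 (C? v)) (𝟙K-cong (∙-congˡ s₀⁻¹≈s₀)))))
        where
        s₀⁻¹≈s₀ : s₀ ⁻¹ ≈ s₀
        s₀⁻¹≈s₀ = sym (inverseʳ-unique s₀ s₀ s₀∙s₀≈ε)

      |K|≡a+5b : ∑ R 𝟙K ≡ a + 5 * b
      |K|≡a+5b = begin
        ∑ R 𝟙K                                                ≡⟨ ∑-translate s₀ 𝟙K-cong ⟨
        ∑ R (λ x → 𝟙K (x ∙ s₀))                               ≡⟨ ∑-by-codewords (λ x≈y → 𝟙K-cong (∙-congʳ x≈y)) invariant ⟩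
        ∑ R (λ v → 𝟙K ((v ∙ s₀ ⁻¹) ∙ s₀) * 𝟙 (C? v)) + 5 * b  ≡⟨ ≡.cong (_+ 5 * b) (∑-cong R (λ v → ≡.cong (_* 𝟙 (C? v)) (𝟙K-cong (//-rightDividesˡ s₀ v)))) ⟩
        a + 5 * b                                             ∎
        where
        invariant : ∀ {t} → K t → ∀ x → 𝟙K ((x ∙ t) ∙ s₀) ≡ 𝟙K (x ∙ s₀)
        invariant Kt x = ≡.trans (𝟙K-cong (xy∙z≈xz∙y x _ s₀)) (𝟙K-invariant Kt (x ∙ s₀))

even⊎odd : ∀ n → 2 ∣ n ⊎ ∃ λ k → n ≡ suc (2 * k)
even⊎odd zero = inj₁ (divides 0 ≡.refl)
even⊎odd (suc n) with even⊎odd n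
... | inj₁ (divides k n≡k*2) = inj₂ (k , ≡.cong suc (≡.trans n≡k*2 (*-comm k 2)))
... | inj₂ (k , n≡1+2k)      = inj₁ (divides (suc k) (≡.cong suc (≡.trans n≡1+2k (≡.cong suc (*-comm 2 k)))))

module _ {c ℓ} {G : AbelianGroup c ℓ} (finite : IsFinite G) where
  open AbelianGroup G

  ¬¬-decidable : ∀ {P : Carrier → Set p} → P Respects _≈_ → ¬ ¬ (∀ x → Dec (P x))
  ¬¬-decidable {P = P} P-resp = let n , f , surjective = finite in
    ¬¬-map (λ decide x → let i , fi≈x = surjective x in map′ (P-resp fi≈x) (P-resp (sym fi≈x)) (decide i))
           (sequence (RawMonad.rawApplicative ¬¬-Monad) (λ i → ¬¬-excluded-middle {A = P (f i)}))

  ¬¬-≈-decidable : ¬ ¬ Decidable _≈_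
  ¬¬-≈-decidable = let n , f , surjective = finite in
    ¬¬-map (λ decide x y → let i , fi≈x = surjective x in map′ (trans (sym fi≈x)) (trans fi≈x) (decide i y))
           (sequence (RawMonad.rawApplicative ¬¬-Monad) (λ i → ¬¬-decidable {P = f i ≈_} (λ y≈z fi≈y → trans fi≈y y≈z)))

module FiveElements {c ℓ} (G : AbelianGroup c ℓ) (s s′ s₀ : AbelianGroup.Carrier G) where
  open AbelianGroup G
  open AbelianGroupProperties G using (⁻¹-involutive; inverseʳ-unique)
  open import Data.List.Membership.Setoid setoid using (_∈_)

  S : Carrier → Set ℓ
  S x = (x ≈ s) ⊎ (x ≈ s ⁻¹) ⊎ (x ≈ s′) ⊎ (x ≈ s′ ⁻¹) ⊎ (x ≈ s₀)

  open PerfectCode G S using (Ball)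

  S-resp : S Respects _≈_
  S-resp x≈y (inj₁ x≈s)                         = inj₁ (trans (sym x≈y) x≈s)
  S-resp x≈y (inj₂ (inj₁ x≈s⁻¹))                = inj₂ (inj₁ (trans (sym x≈y) x≈s⁻¹))
  S-resp x≈y (inj₂ (inj₂ (inj₁ x≈s′)))          = inj₂ (inj₂ (inj₁ (trans (sym x≈y) x≈s′)))
  S-resp x≈y (inj₂ (inj₂ (inj₂ (inj₁ x≈s′⁻¹)))) = inj₂ (inj₂ (inj₂ (inj₁ (trans (sym x≈y) x≈s′⁻¹))))
  S-resp x≈y (inj₂ (inj₂ (inj₂ (inj₂ x≈s₀))))   = inj₂ (inj₂ (inj₂ (inj₂ (trans (sym x≈y) x≈s₀))))

  S-⁻¹ : s₀ ∙ s₀ ≈ ε → ∀ {x} → S x → S (x ⁻¹)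
  S-⁻¹ _       (inj₁ x≈s)                         = inj₂ (inj₁ (⁻¹-cong x≈s))
  S-⁻¹ _       (inj₂ (inj₁ x≈s⁻¹))                = inj₁ (trans (⁻¹-cong x≈s⁻¹) (⁻¹-involutive s))
  S-⁻¹ _       (inj₂ (inj₂ (inj₁ x≈s′)))          = inj₂ (inj₂ (inj₂ (inj₁ (⁻¹-cong x≈s′))))
  S-⁻¹ _       (inj₂ (inj₂ (inj₂ (inj₁ x≈s′⁻¹)))) = inj₂ (inj₂ (inj₁ (trans (⁻¹-cong x≈s′⁻¹) (⁻¹-involutive s′))))
  S-⁻¹ s₀∙s₀≈ε (inj₂ (inj₂ (inj₂ (inj₂ x≈s₀))))   =
    inj₂ (inj₂ (inj₂ (inj₂ (trans (⁻¹-cong x≈s₀) (sym (inverseʳ-unique s₀ s₀ s₀∙s₀≈ε))))))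

  ball : List Carrier
  ball = s₀ ∷ ε ∷ s ∷ s ⁻¹ ∷ s′ ∷ s′ ⁻¹ ∷ []

  ball⊆Ball : All Ball ball
  ball⊆Ball = inj₂ (inj₂ (inj₂ (inj₂ (inj₂ refl)))) ∷ inj₁ refl ∷ inj₂ (inj₁ refl) ∷ inj₂ (inj₂ (inj₁ refl))
            ∷ inj₂ (inj₂ (inj₂ (inj₁ refl))) ∷ inj₂ (inj₂ (inj₂ (inj₂ (inj₁ refl)))) ∷ []

  Ball⊆ball : ∀ {t} → Ball t → t ∈ ball
  Ball⊆ball (inj₁ t≈ε)                                = there (here t≈ε)
  Ball⊆ball (inj₂ (inj₁ t≈s))                         = there (there (here t≈s))
  Ball⊆ball (inj₂ (inj₂ (inj₁ t≈s⁻¹)))                = there (there (there (here t≈s⁻¹)))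
  Ball⊆ball (inj₂ (inj₂ (inj₂ (inj₁ t≈s′))))          = there (there (there (there (here t≈s′))))
  Ball⊆ball (inj₂ (inj₂ (inj₂ (inj₂ (inj₁ t≈s′⁻¹))))) = there (there (there (there (there (here t≈s′⁻¹)))))
  Ball⊆ball (inj₂ (inj₂ (inj₂ (inj₂ (inj₂ t≈s₀)))))   = here t≈s₀

lemma3p3 : {c ℓ : Level} (G : AbelianGroup c ℓ) → IsFinite G →
    (s s′ s₀ : AbelianGroup.Carrier G) →
    let open AbelianGroup G
        S = λ x → (x ≈ s) ⊎ (x ≈ s ⁻¹) ⊎ (x ≈ s′) ⊎ (x ≈ s′ ⁻¹) ⊎ (x ≈ s₀)
    in ¬ (s ≈ ε) → ¬ (s ⁻¹ ≈ ε) → ¬ (s′ ≈ ε) → ¬ (s′ ⁻¹ ≈ ε) → ¬ (s₀ ≈ ε) →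
       ¬ (s ≈ s ⁻¹) → ¬ (s ≈ s′) → ¬ (s ≈ s′ ⁻¹) → ¬ (s ≈ s₀) →
       ¬ (s ⁻¹ ≈ s′) → ¬ (s ⁻¹ ≈ s′ ⁻¹) → ¬ (s ⁻¹ ≈ s₀) →
       ¬ (s′ ≈ s′ ⁻¹) → ¬ (s′ ≈ s₀) → ¬ (s′ ⁻¹ ≈ s₀) →
       Generates G S →
       IsOrder G s₀ 2 →
       (o o′ : ℕ) → IsOrder G s o → IsOrder G s′ o′ → o > 2 → o′ > 2 →
       HasPerfectCode G S →
       2 ∣ o * o′
lemma3p3 G finite s s′ s₀ s≉ε s⁻¹≉ε s′≉ε s′⁻¹≉ε s₀≉ε s≉s⁻¹ s≉s′ s≉s′⁻¹ s≉s₀ s⁻¹≉s′ s⁻¹≉s′⁻¹ s⁻¹≉s₀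
         s′≉s′⁻¹ s′≉s₀ s′⁻¹≉s₀ _ (_ , 2s₀≈ε , _) o o′ (_ , os≈ε , _) (_ , o′s′≈ε , _) _ _ (C , code)
  with even⊎odd (o * o′)
... | inj₁ 2∣oo′            = 2∣oo′
-- The goal is now ⊥, which is ¬¬-stable, so ≈ and membership in the code may be taken decidable.
... | inj₂ (k , oo′≡1+2k) =
  ⊥-elim (¬¬-≈-decidable {G = G} finite λ _≟_ → ¬¬-decidable {G = G} finite (closure-resp {C = C}) λ C? →
    let R , R-unique , R-complete = GroupCounting.enumerate G _≟_ finite in
    OddTiling.¬odd-tiling G _≟_ R R-unique R-complete k
      (annihilates s o o′ os≈ε (*-comm o′ o)) (annihilates s′ o′ o o′s′≈ε ≡.refl) s₀∙s₀≈ε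
      C? closure-resp (∑-𝟙-codeword S-resp (S-⁻¹ s₀∙s₀≈ε) code C? distinct ball⊆Ball Ball⊆ball))
  where
  open AbelianGroup G
  open Multiples G
  open FiveElements G s s′ s₀
  open PerfectCode G S
  open import Data.List.Relation.Unary.Unique.Setoid setoid using (Unique)
  open import Relation.Binary.Properties.Setoid setoid using (≉-sym)

  annihilates : ∀ x m n → mul G m x ≈ ε → n * m ≡ o * o′ → suc (2 * k) × x ≈ ε
  annihilates x m n mx≈ε nm≡oo′ =
    trans (×-congˡ (≡.trans (≡.sym oo′≡1+2k) (≡.sym nm≡oo′))) (×-ε-multiple n (≡.subst (_≈ ε) (mul≡× m x) mx≈ε))

  s₀∙s₀≈ε : s₀ ∙ s₀ ≈ ε
  s₀∙s₀≈ε = trans (∙-congˡ (sym (identityʳ s₀))) 2s₀≈ε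

  distinct : Unique ball
  distinct = (s₀≉ε ∷ ≉-sym s≉s₀ ∷ ≉-sym s⁻¹≉s₀ ∷ ≉-sym s′≉s₀ ∷ ≉-sym s′⁻¹≉s₀ ∷ [])
           ∷ (≉-sym s≉ε ∷ ≉-sym s⁻¹≉ε ∷ ≉-sym s′≉ε ∷ ≉-sym s′⁻¹≉ε ∷ [])
           ∷ (s≉s⁻¹ ∷ s≉s′ ∷ s≉s′⁻¹ ∷ [])
           ∷ (s⁻¹≉s′ ∷ s⁻¹≉s′⁻¹ ∷ [])
           ∷ (s′≉s′⁻¹ ∷ [])
           ∷ [] ∷ []
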